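{- Let $n\ge2$. There is a commutative diagram $$\begin{array}{ccccccccc}0&\to& I_n^{0,1}&\hookrightarrow&\Sigma(B_n)&\xrightarrow{\beta^2}&\Sigma(B_{n-2})&\to&0\\ &&\downarrow\varphi&&\downarrow\varphi&&\downarrow\varphi&&\\ 0&\to&\mathring{\mathfrak P}_n&\hookrightarrow&\mathfrak P_n&\xrightarrow{\pi}&\mathfrak P_{n-2}&\to&0\end{array}$$ in which both rows are exact and the three vertical maps are surjective.
   Context: Notation: $[m]=\{1,\dots,m\}$; for a set $J$ of integers, $J-k=\{j-k:j\in J\}$. Type B: $\mathcal B_n$ is the group of signed permutations (bijections $w$ of $\{\pm1,\dots,\pm n\}$ with $w(-i)=-w(i)$), written $w_1\cdots w_n$, entries ordered $\cdots<\bar2<\bar1<1<2<\cdots$ ($\bar k=-k$); $\mathrm{Des}(w)=\{i\in\{0,\dots,n-1\}: w_i>w_{i+1}\}$ with $w_0=0$. For $J\subseteq\{0,\dots,n-1\}$, $Y_J=\sum_{\mathrm{Des}(w)=J}w$, $X_J=\sum_{I\subseteq J}Y_I$; $\Sigma(B_n)$ is the span of these (Solomon's descent algebra). $\beta^2:\Sigma(B_n)\to\Sigma(B_{n-2})$ is the linear map with $X_J\mapsto X_{J-2}$ if $0,1\notin J$ and $X_J\mapsto 0$ if $0\in J$ or $1\in J$. $I_n^{0,1}=\mathrm{Span}\{X_J: 0\in J\text{ or }1\in J\}$. $\varphi$ is the linear map forgetting signs, $w\mapsto |w_1|\cdots|w_n|$ (for $n-2=0$, the empty permutation goes to the empty permutation).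 Type A: for $w\in\mathcal S_n$, $\mathrm{Peak}(w)=\{i\in[n-1]:w_{i-1}<w_i>w_{i+1}\}$ with $w_0=0$, and $\mathring{\mathrm{Peak}}(w)=\mathrm{Peak}(w)\setminus\{1\}$. $\mathcal F_n$: subsets of $[n-1]$ with no two consecutive integers; $\mathring{\mathcal F}_n=\{F\in\mathcal F_n:1\notin F\}$. $P_F=\sum_{\mathrm{Peak}(w)=F}w$ ($F\in\mathcal F_n$), $\mathring P_F=\sum_{\mathring{\mathrm{Peak}}(w)=F}w$ ($F\in\mathring{\mathcal F}_n$); $\mathfrak P_n=\mathrm{Span}\{P_F\}$, $\mathring{\mathfrak P}_n=\mathrm{Span}\{\mathring P_F\}$, $\mathfrak P_0=\mathbb Q$. $\pi:\mathfrak P_n\to\mathfrak P_{n-2}$ is the linear map with $P_F\mapsto P_{F-2}$ if $1,2\notin F$; $P_F\mapsto -P_{(F\setminus\{1\})-2}$ if $1\in F$; $P_F\mapsto 0$ if $2\in F$. -}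

module Defs where

open import Data.Bool using (Bool; true; false; _∧_; _∨_; not; if_then_else_)
open import Data.Nat using (ℕ; zero; suc; _<ᵇ_; _≡ᵇ_; _≤ᵇ_)
open import Data.Integer as ℤ using (ℤ; ∣_∣; +_)
import Data.Integer.Properties as ℤP
open import Data.Rational as ℚ using (ℚ; 0ℚ; 1ℚ)
open import Data.List using (List; []; _∷_; _++_; map; foldr; filter)
open import Data.Vec as V using (Vec; []; _∷_)
open import Data.Product using (_×_; ∃)
open import Relation.Nullary.Decidable using (⌊_⌋)
open import Relation.Binary.PropositionalEquality using (_≡_)

-- A subset of {0,…,n-1} is encoded as a Vec Bool n (entry i ↔ element i).
Subset : ℕ → Set
Subset n = Vec Bool n

allSubsets : (n : ℕ) → List (Subset n)
allSubsets zero    = [] ∷ []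
allSubsets (suc n) = map (false ∷_) (allSubsets n) ++ map (true ∷_) (allSubsets n)

eqSub : ∀ {n} → Subset n → Subset n → Bool
eqSub []       []       = true
eqSub (a ∷ as) (b ∷ bs) = (if a then b else not b) ∧ eqSub as bs

subSub : ∀ {n} → Subset n → Subset n → Bool
subSub []       []       = true
subSub (a ∷ as) (b ∷ bs) = (not a ∨ b) ∧ subSub as bs

ind : Bool → ℚ
ind b = if b then 1ℚ else 0ℚ

sumℚ : List ℚ → ℚ
sumℚ = foldr ℚ._+_ 0ℚ

sumOver : (n : ℕ) → (Subset n → Bool) → (Subset n → ℚ) → ℚ
sumOver n p g = sumℚ (map g (filter (λ S → Data.Bool._≟_ (p S) true) (allSubsets n)))
  where import Data.Bool

-- Group algebras: an element of ℚ[B_n] (resp. ℚ[S_n]) is given by its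
-- coefficient function on words; only signed permutations (resp.
-- permutations) matter.  Equality is pointwise.

QB : ℕ → Set
QB n = Vec ℤ n → ℚ

QA : ℕ → Set
QA n = Vec ℕ n → ℚ

_≈B_ : ∀ {n} → QB n → QB n → Set
f ≈B g = ∀ w → f w ≡ g w

_≈A_ : ∀ {n} → QA n → QA n → Set
f ≈A g = ∀ u → f u ≡ g u

zeroB : ∀ {n} → QB n
zeroB _ = 0ℚ

zeroA : ∀ {n} → QA n
zeroA _ = 0ℚ

elemℕ : ℕ → List ℕ → Bool
elemℕ x []       = false
elemℕ x (y ∷ ys) = (x ≡ᵇ y) ∨ elemℕ x ys

distinct : List ℕ → Bool
distinct []       = true
distinct (x ∷ xs) = not (elemℕ x xs) ∧ distinct xs

inRange : ℕ → List ℕ → Bool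
inRange n []       = true
inRange n (x ∷ xs) = (1 ≤ᵇ x) ∧ (x ≤ᵇ n) ∧ inRange n xs

isPerm : ∀ {n} → Vec ℕ n → Bool
isPerm {n} u = inRange n (V.toList u) ∧ distinct (V.toList u)

isSignedPerm : ∀ {n} → Vec ℤ n → Bool
isSignedPerm w = isPerm (V.map ∣_∣ w)

-- Type B descents: Des(w) ⊆ {0,…,n-1}, with w₀ = 0.

_>ℤ_ : ℤ → ℤ → Bool
x >ℤ y = ⌊ y ℤP.<? x ⌋

desFrom : ∀ {n} → ℤ → Vec ℤ n → Subset n
desFrom prev []       = []
desFrom prev (x ∷ xs) = (prev >ℤ x) ∷ desFrom x xs

Des : ∀ {n} → Vec ℤ n → Subset n
Des w = desFrom (+ 0) w

Y : ∀ {n} → Subset n → QB n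
Y J w = ind (isSignedPerm w ∧ eqSub (Des w) J)

X : ∀ {n} → Subset n → QB n
X {n} J w = sumOver n (λ I → subSub I J) (λ I → Y I w)

-- Σ_J c_J X_J  (a general element of Σ(B_n), given by coefficients)
Xcomb : ∀ {n} → (Subset n → ℚ) → QB n
Xcomb {n} c w = sumOver n (λ _ → true) (λ J → c J ℚ.* X J w)

has01 : ∀ {m} → Subset (suc (suc m)) → Bool
has01 (a ∷ b ∷ _) = a ∨ b

InI01 : ∀ {m} → QB (suc (suc m)) → Set
InI01 {m} f = ∃ λ (e : Subset (suc (suc m)) → ℚ) →
  (∀ J → has01 J ≡ false → e J ≡ 0ℚ) × (f ≈B Xcomb e)

-- β² on basis elements: X_J ↦ X_{J-2} if 0,1 ∉ J, X_J ↦ 0 otherwise.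
-- (For J = a ∷ b ∷ J', the set J-2 is encoded by J'.)
β²basis : ∀ {m} → Subset (suc (suc m)) → QB m
β²basis (a ∷ b ∷ J') = if a ∨ b then zeroB else X J'

β² : ∀ {m} → (Subset (suc (suc m)) → ℚ) → QB m
β² {m} c w = sumOver (suc (suc m)) (λ _ → true) (λ J → c J ℚ.* β²basis J w)

-- φ : ℚ[B_n] → ℚ[S_n], linear extension of w ↦ |w₁|⋯|wₙ|.
-- The coefficient of a permutation u in φ(f) is Σ_{w : |w| = u} f(w);
-- the w with |w| = u are obtained from u by choosing signs.

applySigns : ∀ {n} → Subset n → Vec ℕ n → Vec ℤ n
applySigns []       []       = []
applySigns (s ∷ ss) (x ∷ xs) = (if s then ℤ.- (+ x) else + x) ∷ applySigns ss xs

φ : ∀ {n} → QB n → QA n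
φ {n} f u = if isPerm u then sumOver n (λ _ → true) (λ s → f (applySigns s u)) else 0ℚ

-- Type A peaks.  Peak sets ⊆ [n-1] are encoded as Subset n
-- (entry i ↔ element i; entry 0 is always false).

peaksTail : ∀ {k} → ℕ → Vec ℕ (suc k) → Vec Bool k
peaksTail prev (x ∷ [])    = []
peaksTail prev (x ∷ y ∷ r) = ((prev <ᵇ x) ∧ (y <ᵇ x)) ∷ peaksTail x (y ∷ r)

-- Peak(u) with u₀ = 0
Peak : ∀ {n} → Vec ℕ n → Subset n
Peak []      = []
Peak (x ∷ r) = false ∷ peaksTail 0 (x ∷ r)

remove1 : ∀ {n} → Subset n → Subset n
remove1 (a ∷ b ∷ r) = a ∷ false ∷ r
remove1 S           = S

Peak° : ∀ {n} → Vec ℕ n → Subset n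
Peak° u = remove1 (Peak u)

noConsec : ∀ {n} → Subset n → Bool
noConsec []          = true
noConsec (a ∷ [])    = true
noConsec (a ∷ b ∷ r) = not (a ∧ b) ∧ noConsec (b ∷ r)

head0 : ∀ {n} → Subset n → Bool
head0 []      = false
head0 (a ∷ _) = a

head1 : ∀ {n} → Subset n → Bool
head1 (a ∷ b ∷ _) = b
head1 _           = false

inF : ∀ {n} → Subset n → Bool
inF F = not (head0 F) ∧ noConsec F

inF° : ∀ {n} → Subset n → Bool
inF° F = inF F ∧ not (head1 F)

P : ∀ {n} → Subset n → QA n
P F u = ind (isPerm u ∧ eqSub (Peak u) F)

P° : ∀ {n} → Subset n → QA n
P° F u = ind (isPerm u ∧ eqSub (Peak° u) F)

-- Σ_{F ∈ 𝓕_n} d_F P_F  (a general element of 𝔓_n)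
Pcomb : ∀ {n} → (Subset n → ℚ) → QA n
Pcomb {n} d u = sumOver n inF (λ F → d F ℚ.* P F u)

-- Σ_{F ∈ 𝓕̊_n} e_F P̊_F  (a general element of 𝔓̊_n)
P°comb : ∀ {n} → (Subset n → ℚ) → QA n
P°comb {n} e u = sumOver n inF° (λ F → e F ℚ.* P° F u)

InP° : ∀ {n} → QA n → Set
InP° {n} f = ∃ λ (e : Subset n → ℚ) → f ≈A P°comb e

-- π on basis elements, for F = a ∷ b ∷ F' (F' encodes F-2, resp. (F∖{1})-2):
--   1 ∈ F          ↦ -P_{(F∖{1})-2}
--   2 ∈ F          ↦ 0
--   1,2 ∉ F        ↦ P_{F-2}
πbasis : ∀ {m} → Subset (suc (suc m)) → QA m
πbasis (a ∷ b ∷ F') =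
  if b then (λ u → ℚ.- P F' u)
  else if head0 F' then zeroA
  else P F'

π : ∀ {m} → (Subset (suc (suc m)) → ℚ) → QA m
π {m} d u = sumOver (suc (suc m)) inF (λ F → d F ℚ.* πbasis F u)

-- The content of Corollary 5.10, for n = m + 2.

record Corollary5p10 (m : ℕ) : Set where
  field
    I01⊆Σ      : ∀ f → InI01 {m} f → ∃ λ c → f ≈B Xcomb c
    P°⊆P       : ∀ e → ∃ λ d → P°comb {suc (suc m)} e ≈A Pcomb d
    topExact   : ∀ c → (β² {m} c ≈B zeroB → InI01 (Xcomb c))
                     × (InI01 (Xcomb c) → β² {m} c ≈B zeroB)
    topSurj    : ∀ (c' : Subset m → ℚ) → ∃ λ c → β² {m} c ≈B Xcomb c'
    botExact   : ∀ d → (π {m} d ≈A zeroA → InP° (Pcomb d))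
                     × (InP° (Pcomb d) → π {m} d ≈A zeroA)
    botSurj    : ∀ (d' : Subset m → ℚ) → ∃ λ d → π {m} d ≈A Pcomb d'
    φI01       : ∀ f → InI01 {m} f → InP° (φ f)
    φΣn        : ∀ (c : Subset (suc (suc m)) → ℚ) → ∃ λ d → φ (Xcomb c) ≈A Pcomb d
    φΣm        : ∀ (c : Subset m → ℚ) → ∃ λ d → φ (Xcomb c) ≈A Pcomb d
    -- the right square commutes: π ∘ φ = φ ∘ β²
    -- (for every expression of φ(x) in the basis P_F)
    commute    : ∀ (c : Subset (suc (suc m)) → ℚ) d →
                   φ (Xcomb c) ≈A Pcomb d → π d ≈A φ (β² c)
    φI01-surj  : ∀ (e : Subset (suc (suc m)) → ℚ) →
                   ∃ λ f → InI01 {m} f × (φ f ≈A P°comb e)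
    φΣn-surj   : ∀ (d : Subset (suc (suc m)) → ℚ) → ∃ λ c → φ (Xcomb c) ≈A Pcomb d
    φΣm-surj   : ∀ (d : Subset m → ℚ) → ∃ λ c → φ (Xcomb c) ≈A Pcomb d

{-# OPTIONS --safe #-}
-- Everything is computed in coordinates. Σ_J c_J X_J takes at a signed permutation w the value
-- Σ_{J ⊇ Des w} c_J, and φ sums over the 2^n signings of a permutation u. Scanning u from left to
-- right (whether i is a descent depends only on the signs of w_i and w_{i+1}) shows that the number
-- of signings with all descents in J is κ(Peak u, J) := peakWeight false (Peak u) J, which is 2^|J|
-- if every peak i of u has i-1 ∈ J or i ∈ J, and 0 otherwise. Hence φ(Σ c_J X_J) = Σ_F (Σ_J c_J κ(F,J)) P_F.
-- The rows are exact because the X_J are linearly independent (test against signed permutations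
-- with a prescribed descent set) and every F ∈ 𝓕_n is the peak set of a permutation. The square
-- commutes because κ(00G, J) - κ(01G, J) = [0,1 ∉ J] κ(G, J-2), and the vertical maps are onto
-- because κ is triangular in the first position, so Σ_J c_J κ(F,J) = d_F can be solved recursively.
module Submission where

open import Defs
open import Data.Bool using (Bool; true; false; _∧_; _∨_; not; if_then_else_; T; _≟_)
open import Data.Bool.Properties using (∧-zeroʳ; ∨-zeroʳ; ∧-conicalˡ; ∧-conicalʳ; T-≡)
open import Data.Nat as ℕ using (ℕ; zero; suc; _<ᵇ_; _≡ᵇ_; _≤ᵇ_)
import Data.Nat.Properties as ℕ
open import Data.Integer as ℤ using (ℤ; ∣_∣; -[1+_])
import Data.Integer.Properties as ℤ
open import Data.Rational using (ℚ; 0ℚ; 1ℚ; ½; _+_; _*_; _-_; -_)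
open import Data.Rational.Properties
  using (+-0-abelianGroup; +-0-commutativeMonoid; *-1-commutativeMonoid; +-identityʳ; +-identityˡ; +-assoc; +-inverseʳ;
         *-zeroʳ; *-zeroˡ; *-identityˡ; *-identityʳ; *-assoc; *-distribˡ-+)
open import Data.Rational.Solver using (module +-*-Solver)
open import Data.List using (List; []; _∷_; _++_; map; filter)
open import Data.List.Relation.Unary.All as All using (All; []; _∷_)
open import Data.Vec as V using (Vec; []; _∷_)
open import Data.Product using (_×_; ∃; _,_; proj₁; proj₂)
open import Data.Unit using (⊤; tt)
open import Data.Empty using (⊥-elim)
open import Function.Bundles using (Equivalence)
open import Relation.Nullary using (¬_; Dec)
open import Relation.Nullary.Decidable using (isYes≗does)
open import Relation.Nullary.Reflects using (Reflects; ofʸ; ofⁿ; det; fromEquivalence)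
open import Relation.Binary.PropositionalEquality
open import Relation.Binary.Definitions using (tri<; tri≈; tri>)

open import Algebra.Bundles using (CommutativeMonoid)
open import Algebra.Properties.AbelianGroup +-0-abelianGroup
  using (∙-cancelʳ; //-rightDividesˡ; x∙y⁻¹≈ε⇒x≈y)
open import Algebra.Properties.CommutativeSemigroup (CommutativeMonoid.commutativeSemigroup +-0-commutativeMonoid)
  using () renaming (interchange to +-interchange)
open import Algebra.Properties.CommutativeSemigroup (CommutativeMonoid.commutativeSemigroup *-1-commutativeMonoid)
  using () renaming (x∙yz≈y∙xz to *-leftSwap)
open +-*-Solver using (solve; _:+_; _:*_; _:-_; :-_; _:=_)

private
  variable
    A B : Set

sumMap : (A → ℚ) → List A → ℚ
sumMap f xs = sumℚ (map f xs)

sumMap-++ : (f : A → ℚ) (xs ys : List A) → sumMap f (xs ++ ys) ≡ sumMap f xs + sumMap f ys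
sumMap-++ f []       ys = sym (+-identityˡ _)
sumMap-++ f (x ∷ xs) ys = trans (cong (f x +_) (sumMap-++ f xs ys)) (sym (+-assoc (f x) _ _))

sumMap-map : (f : B → ℚ) (g : A → B) (xs : List A) →
             sumMap f (map g xs) ≡ sumMap (λ x → f (g x)) xs
sumMap-map f g []       = refl
sumMap-map f g (x ∷ xs) = cong (f (g x) +_) (sumMap-map f g xs)

sumMap-cong : {f g : A → ℚ} → (∀ x → f x ≡ g x) → (xs : List A) → sumMap f xs ≡ sumMap g xs
sumMap-cong f≗g []       = refl
sumMap-cong f≗g (x ∷ xs) = cong₂ _+_ (f≗g x) (sumMap-cong f≗g xs)

sumMap-zero : {f : A → ℚ} → (∀ x → f x ≡ 0ℚ) → (xs : List A) → sumMap f xs ≡ 0ℚ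
sumMap-zero f≗0 []       = refl
sumMap-zero f≗0 (x ∷ xs) = trans (cong₂ _+_ (f≗0 x) (sumMap-zero f≗0 xs)) (+-identityˡ 0ℚ)

sumMap-+ : (f g : A → ℚ) (xs : List A) → sumMap (λ x → f x + g x) xs ≡ sumMap f xs + sumMap g xs
sumMap-+ f g []       = refl
sumMap-+ f g (x ∷ xs) = trans (cong ((f x + g x) +_) (sumMap-+ f g xs)) (+-interchange (f x) (g x) _ _)

sumMap-* : (c : ℚ) (f : A → ℚ) (xs : List A) → sumMap (λ x → c * f x) xs ≡ c * sumMap f xs
sumMap-* c f []       = sym (*-zeroʳ c)
sumMap-* c f (x ∷ xs) = trans (cong ((c * f x) +_) (sumMap-* c f xs)) (sym (*-distribˡ-+ c (f x) _))

sumMap-sub : (f g : A → ℚ) (xs : List A) → sumMap (λ x → f x - g x) xs ≡ sumMap f xs - sumMap g xs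
sumMap-sub f g []       = refl
sumMap-sub f g (x ∷ xs) = trans (cong ((f x - g x) +_) (sumMap-sub f g xs)) (interchange (f x) _ (g x) _)
  where
  interchange : ∀ a b c d → (a - c) + (b - d) ≡ (a + b) - (c + d)
  interchange = solve 4 (λ a b c d → (a :- c) :+ (b :- d) := (a :+ b) :- (c :+ d)) refl

sumMap-swap : (h : A → B → ℚ) (xs : List A) (ys : List B) →
              sumMap (λ x → sumMap (h x) ys) xs ≡ sumMap (λ y → sumMap (λ x → h x y) xs) ys
sumMap-swap h []       ys = sym (sumMap-zero (λ _ → refl) ys)
sumMap-swap h (x ∷ xs) ys = trans (cong (sumMap (h x) ys +_) (sumMap-swap h xs ys))
                                  (sym (sumMap-+ (h x) (λ y → sumMap (λ x → h x y) xs) ys))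

sumℚ-filter : (p : A → Bool) (g : A → ℚ) (xs : List A) →
              sumℚ (map g (filter (λ x → p x ≟ true) xs))
                ≡ sumMap (λ x → if p x then g x else 0ℚ) xs
sumℚ-filter p g []       = refl
sumℚ-filter p g (x ∷ xs) with p x
... | true  = cong (g x +_) (sumℚ-filter p g xs)
... | false = trans (sumℚ-filter p g xs) (sym (+-identityˡ _))

sumAll : (n : ℕ) → (Subset n → ℚ) → ℚ
sumAll n h = sumMap h (allSubsets n)

sumOver≡sumAll : ∀ n p (g : Subset n → ℚ) → sumOver n p g ≡ sumAll n (λ I → if p I then g I else 0ℚ)
sumOver≡sumAll n p g = sumℚ-filter p g (allSubsets n)

sumAll-[] : (h : Subset 0 → ℚ) → sumAll 0 h ≡ h []
sumAll-[] h = +-identityʳ (h [])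

sumAll-suc : ∀ n (h : Subset (suc n) → ℚ) →
             sumAll (suc n) h ≡ sumAll n (λ I → h (false ∷ I)) + sumAll n (λ I → h (true ∷ I))
sumAll-suc n h = trans (sumMap-++ h (map (false ∷_) subsets) (map (true ∷_) subsets))
                       (cong₂ _+_ (sumMap-map h (false ∷_) subsets) (sumMap-map h (true ∷_) subsets))
  where subsets = allSubsets n

sumAll-suc² : ∀ m (h : Subset (suc (suc m)) → ℚ) → sumAll (suc (suc m)) h ≡
  (sumAll m (λ I → h (false ∷ false ∷ I)) + sumAll m (λ I → h (false ∷ true ∷ I)))
  + (sumAll m (λ I → h (true ∷ false ∷ I)) + sumAll m (λ I → h (true ∷ true ∷ I)))
sumAll-suc² m h = trans (sumAll-suc (suc m) h)
  (cong₂ _+_ (sumAll-suc m (λ I → h (false ∷ I))) (sumAll-suc m (λ I → h (true ∷ I))))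

sumAll-cong : ∀ n {f g : Subset n → ℚ} → (∀ I → f I ≡ g I) → sumAll n f ≡ sumAll n g
sumAll-cong n f≗g = sumMap-cong f≗g (allSubsets n)

sumAll-zero : ∀ n {f : Subset n → ℚ} → (∀ I → f I ≡ 0ℚ) → sumAll n f ≡ 0ℚ
sumAll-zero n f≗0 = sumMap-zero f≗0 (allSubsets n)

sumAll-* : ∀ n c (f : Subset n → ℚ) → sumAll n (λ I → c * f I) ≡ c * sumAll n f
sumAll-* n c f = sumMap-* c f (allSubsets n)

sumAll-sub : ∀ n (f g : Subset n → ℚ) → sumAll n (λ I → f I - g I) ≡ sumAll n f - sumAll n g
sumAll-sub n f g = sumMap-sub f g (allSubsets n)

sumAll-swap : ∀ n k (h : Subset n → Subset k → ℚ) →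
              sumAll n (λ I → sumAll k (h I)) ≡ sumAll k (λ J → sumAll n (λ I → h I J))
sumAll-swap n k h = sumMap-swap h (allSubsets n) (allSubsets k)

sumAll-eqSub : ∀ n (D : Subset n) (g : Subset n → ℚ) → sumAll n (λ I → ind (eqSub D I) * g I) ≡ g D
sumAll-eqSub zero    []          g = trans (sumAll-[] (λ I → ind (eqSub [] I) * g I)) (*-identityˡ (g []))
sumAll-eqSub (suc n) (false ∷ D) g = begin
  sumAll (suc n) (λ I → ind (eqSub (false ∷ D) I) * g I)
    ≡⟨ sumAll-suc n _ ⟩
  sumAll n (λ I → ind (eqSub D I) * g (false ∷ I)) + sumAll n (λ I → 0ℚ * g (true ∷ I))
    ≡⟨ cong₂ _+_ (sumAll-eqSub n D (λ I → g (false ∷ I))) (sumAll-zero n (λ I → *-zeroˡ (g (true ∷ I)))) ⟩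
  g (false ∷ D) + 0ℚ
    ≡⟨ +-identityʳ _ ⟩
  g (false ∷ D) ∎
  where open ≡-Reasoning
sumAll-eqSub (suc n) (true ∷ D) g = begin
  sumAll (suc n) (λ I → ind (eqSub (true ∷ D) I) * g I)
    ≡⟨ sumAll-suc n _ ⟩
  sumAll n (λ I → 0ℚ * g (false ∷ I)) + sumAll n (λ I → ind (eqSub D I) * g (true ∷ I))
    ≡⟨ cong₂ _+_ (sumAll-zero n (λ I → *-zeroˡ (g (false ∷ I)))) (sumAll-eqSub n D (λ I → g (true ∷ I))) ⟩
  0ℚ + g (true ∷ D)
    ≡⟨ +-identityˡ _ ⟩
  g (true ∷ D) ∎
  where open ≡-Reasoning

ind-∧ : ∀ a b → ind (a ∧ b) ≡ ind a * ind b
ind-∧ true  b = sym (*-identityˡ (ind b))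
ind-∧ false b = sym (*-zeroˡ (ind b))

*-cong-zeroˡ : ∀ {a x y} → a ≡ 0ℚ → a * x ≡ a * y
*-cong-zeroˡ {x = x} {y} a≡0 =
  trans (cong (_* x) a≡0) (trans (*-zeroˡ x) (sym (trans (cong (_* y) a≡0) (*-zeroˡ y))))

if-else-0≡ind* : ∀ b x → (if b then x else 0ℚ) ≡ ind b * x
if-else-0≡ind* true  x = sym (*-identityˡ x)
if-else-0≡ind* false x = sym (*-zeroˡ x)

if-else-0-cong : ∀ b {x y : ℚ} → (b ≡ true → x ≡ y) → (if b then x else 0ℚ) ≡ (if b then y else 0ℚ)
if-else-0-cong true  x≡y = x≡y refl
if-else-0-cong false _   = refl

T⇒≡true : ∀ {b} → T b → b ≡ true
T⇒≡true = Equivalence.to T-≡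

≡true⇒T : ∀ {b} → b ≡ true → T b
≡true⇒T = Equivalence.from T-≡

<ᵇ-true : ∀ {m n} → m ℕ.< n → (m <ᵇ n) ≡ true
<ᵇ-true {m} {n} m<n = det (ℕ.<ᵇ-reflects-< m n) (ofʸ m<n)

<ᵇ-false : ∀ m n → ¬ m ℕ.< n → (m <ᵇ n) ≡ false
<ᵇ-false m n m≮n = det (ℕ.<ᵇ-reflects-< m n) (ofⁿ m≮n)

≡ᵇ-false : ∀ {m n} → m ≢ n → (m ≡ᵇ n) ≡ false
≡ᵇ-false {m} {n} m≢n = det (fromEquivalence (ℕ.≡ᵇ⇒≡ m n) (ℕ.≡⇒≡ᵇ m n)) (ofⁿ m≢n)

<ᵇ-flip : ∀ y z → y ≢ z → (y <ᵇ z) ≡ not (z <ᵇ y)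
<ᵇ-flip y z y≢z with ℕ.<-cmp y z
... | tri< y<z _ z≮y = trans (<ᵇ-true y<z) (cong not (sym (<ᵇ-false z y z≮y)))
... | tri≈ _ y≡z _   = ⊥-elim (y≢z y≡z)
... | tri> y≮z _ z<y = trans (<ᵇ-false y z y≮z) (cong not (sym (<ᵇ-true z<y)))

>ℤ-reflects : ∀ x y → Reflects (y ℤ.< x) (x >ℤ y)
>ℤ-reflects x y = subst (Reflects _) (sym (isYes≗does (y ℤ.<? x))) (Dec.proof (y ℤ.<? x))

>ℤ-true : ∀ {x y} → y ℤ.< x → (x >ℤ y) ≡ true
>ℤ-true {x} {y} y<x = det (>ℤ-reflects x y) (ofʸ y<x)

>ℤ-false : ∀ {x y} → ¬ y ℤ.< x → (x >ℤ y) ≡ false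
>ℤ-false {x} {y} y≮x = det (>ℤ-reflects x y) (ofⁿ y≮x)

pos>pos : ∀ y z → ((ℤ.+ y) >ℤ (ℤ.+ z)) ≡ (z <ᵇ y)
pos>pos y z = det (>ℤ-reflects _ _)
  (fromEquivalence (λ t → ℤ.+<+ (ℕ.<ᵇ⇒< z y t)) (λ { (ℤ.+<+ z<y) → ℕ.<⇒<ᵇ z<y }))

pos>neg : ∀ y z → 1 ℕ.≤ z → ((ℤ.+ y) >ℤ (ℤ.- (ℤ.+ z))) ≡ true
pos>neg y (suc z) _ = >ℤ-true (ℤ.-<+ {z} {y})

neg>pos : ∀ y z → ((ℤ.- (ℤ.+ y)) >ℤ (ℤ.+ z)) ≡ false
neg>pos zero    z = >ℤ-false {ℤ.+ 0} {ℤ.+ z} (λ { (ℤ.+<+ ()) })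
neg>pos (suc y) z = >ℤ-false { -[1+ y ] } {ℤ.+ z} (λ ())

neg>neg : ∀ y z → ((ℤ.- (ℤ.+ y)) >ℤ (ℤ.- (ℤ.+ z))) ≡ (y <ᵇ z)
neg>neg zero    zero    = >ℤ-false {ℤ.+ 0} {ℤ.+ 0} (λ { (ℤ.+<+ ()) })
neg>neg (suc y) zero    = >ℤ-false { -[1+ y ] } {ℤ.+ 0} (λ ())
neg>neg zero    (suc z) = >ℤ-true (ℤ.-<+ {z} {0})
neg>neg (suc y) (suc z) = det (>ℤ-reflects _ _)
  (fromEquivalence (λ t → ℤ.-<- (ℕ.<ᵇ⇒< y z t)) (λ { (ℤ.-<- y<z) → ℕ.<⇒<ᵇ y<z }))

noConsec-false∷ : ∀ {n} (F : Subset n) → noConsec (false ∷ F) ≡ noConsec F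
noConsec-false∷ []      = refl
noConsec-false∷ (b ∷ F) = refl

noConsec-true∷⇒inF : ∀ {n} (F : Subset n) → noConsec (true ∷ F) ≡ true → inF F ≡ true
noConsec-true∷⇒inF []          _  = refl
noConsec-true∷⇒inF (false ∷ F) nc = nc

noConsec-∷ : ∀ {n} f (F : Subset n) → noConsec (f ∷ F) ≡ true → noConsec F ≡ true
noConsec-∷ f []      _  = refl
noConsec-∷ f (b ∷ F) nc = ∧-conicalʳ _ _ nc

no-adjacent-peaks : ∀ a b c d → (b ≡ true → c ≡ false) → not ((a ∧ b) ∧ (c ∧ d)) ≡ true
no-adjacent-peaks false b     c d _   = refl
no-adjacent-peaks true  false c d _   = refl
no-adjacent-peaks true  true  c d b⇒¬c rewrite b⇒¬c refl = refl

noConsec-peaksTail : ∀ {k} p (v : Vec ℕ (suc k)) → noConsec (peaksTail p v) ≡ true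
noConsec-peaksTail p (x ∷ [])         = refl
noConsec-peaksTail p (x ∷ y ∷ [])     = refl
noConsec-peaksTail p (x ∷ y ∷ z ∷ r) =
  cong₂ _∧_ (no-adjacent-peaks (p <ᵇ x) (y <ᵇ x) (x <ᵇ y) (z <ᵇ y) y<x⇒x≮y) (noConsec-peaksTail x (y ∷ z ∷ r))
  where
  y<x⇒x≮y : (y <ᵇ x) ≡ true → (x <ᵇ y) ≡ false
  y<x⇒x≮y y<x = <ᵇ-false x y (ℕ.<⇒≯ (ℕ.<ᵇ⇒< y x (≡true⇒T y<x)))

noConsec-Peak : ∀ {n} (u : Vec ℕ n) → noConsec (Peak u) ≡ true
noConsec-Peak []      = refl
noConsec-Peak (x ∷ u) = trans (noConsec-false∷ (peaksTail 0 (x ∷ u))) (noConsec-peaksTail 0 (x ∷ u))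

inF-false∷false∷Peak : ∀ {m} (u : Vec ℕ m) → inF (false ∷ false ∷ Peak u) ≡ true
inF-false∷false∷Peak u = trans (noConsec-false∷ (Peak u)) (noConsec-Peak u)

inF-false∷true∷Peak : ∀ {n} (u : Vec ℕ n) → inF (false ∷ true ∷ Peak u) ≡ true
inF-false∷true∷Peak []      = refl
inF-false∷true∷Peak (x ∷ u) = noConsec-Peak (x ∷ u)

head0-Peak : ∀ {n} (u : Vec ℕ n) → head0 (Peak u) ≡ false
head0-Peak []      = refl
head0-Peak (x ∷ u) = refl

Peak-inF : ∀ {n} (u : Vec ℕ n) → inF (Peak u) ≡ true
Peak-inF u = cong₂ (λ h nc → not h ∧ nc) (head0-Peak u) (noConsec-Peak u)

Peak°-inF° : ∀ {n} (u : Vec ℕ n) → inF° (Peak° u) ≡ true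
Peak°-inF° []          = refl
Peak°-inF° (x ∷ [])    = refl
Peak°-inF° (x ∷ y ∷ u) = cong (_∧ true) (trans (noConsec-false∷ (peaksTail x (y ∷ u))) (noConsec-peaksTail x (y ∷ u)))

if-ind-∧ : ∀ a b c → (if a then ind (b ∧ c) else 0ℚ) ≡ ind c * ind (b ∧ a)
if-ind-∧ true  true  true  = refl
if-ind-∧ true  true  false = refl
if-ind-∧ true  false true  = refl
if-ind-∧ true  false false = refl
if-ind-∧ false true  true  = refl
if-ind-∧ false true  false = refl
if-ind-∧ false false true  = refl
if-ind-∧ false false false = refl

X-eval : ∀ {n} (J : Subset n) w → X J w ≡ ind (isSignedPerm w ∧ subSub (Des w) J)
X-eval {n} J w = begin
  X J w
    ≡⟨ sumOver≡sumAll n (λ I → subSub I J) (λ I → Y I w) ⟩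
  sumAll n (λ I → if subSub I J then ind (isSignedPerm w ∧ eqSub (Des w) I) else 0ℚ)
    ≡⟨ sumAll-cong n (λ I → if-ind-∧ (subSub I J) (isSignedPerm w) (eqSub (Des w) I)) ⟩
  sumAll n (λ I → ind (eqSub (Des w) I) * ind (isSignedPerm w ∧ subSub I J))
    ≡⟨ sumAll-eqSub n (Des w) (λ I → ind (isSignedPerm w ∧ subSub I J)) ⟩
  ind (isSignedPerm w ∧ subSub (Des w) J) ∎
  where open ≡-Reasoning

Xcomb-eval : ∀ {n} (c : Subset n → ℚ) w → Xcomb c w ≡ sumAll n (λ J → c J * X J w)
Xcomb-eval {n} c w = sumOver≡sumAll n (λ _ → true) (λ J → c J * X J w)

if-*-ind-∧ : ∀ v x b e → (if v then x * ind (b ∧ e) else 0ℚ) ≡ ind e * (if v ∧ b then x else 0ℚ)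
if-*-ind-∧ false x b     e     = sym (*-zeroʳ (ind e))
if-*-ind-∧ true  x true  true  = trans (*-identityʳ x) (sym (*-identityˡ x))
if-*-ind-∧ true  x true  false = trans (*-zeroʳ x) (sym (*-zeroˡ x))
if-*-ind-∧ true  x false e     = trans (*-zeroʳ x) (sym (*-zeroʳ (ind e)))

sumAll-select : ∀ n (valid : Subset n → Bool) (d : Subset n → ℚ) b D → valid D ≡ true →
  sumAll n (λ F → if valid F then d F * ind (b ∧ eqSub D F) else 0ℚ) ≡ (if b then d D else 0ℚ)
sumAll-select n valid d b D valid-D =
  trans (sumAll-cong n (λ F → if-*-ind-∧ (valid F) (d F) b (eqSub D F)))
   (trans (sumAll-eqSub n D (λ F → if valid F ∧ b then d F else 0ℚ))
          (cong (λ v → if v ∧ b then d D else 0ℚ) valid-D))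

Pcomb-eval : ∀ {n} (d : Subset n → ℚ) u → Pcomb d u ≡ (if isPerm u then d (Peak u) else 0ℚ)
Pcomb-eval {n} d u = trans (sumOver≡sumAll n inF (λ F → d F * P F u))
                           (sumAll-select n inF d (isPerm u) (Peak u) (Peak-inF u))

P°comb-eval : ∀ {n} (e : Subset n → ℚ) u → P°comb e u ≡ (if isPerm u then e (Peak° u) else 0ℚ)
P°comb-eval {n} e u = trans (sumOver≡sumAll n inF° (λ F → e F * P° F u))
                            (sumAll-select n inF° e (isPerm u) (Peak° u) (Peak°-inF° u))

φ-eval : ∀ {n} (f : QB n) u → φ f u ≡ (if isPerm u then sumAll n (λ s → f (applySigns s u)) else 0ℚ)
φ-eval {n} f u = cong (λ t → if isPerm u then t else 0ℚ) (sumOver≡sumAll n (λ _ → true) (λ s → f (applySigns s u)))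

φ-cong : ∀ {n} {f g : QB n} → f ≈B g → φ f ≈A φ g
φ-cong {n} {f} {g} f≈g u =
  trans (φ-eval f u)
   (trans (cong (λ t → if isPerm u then t else 0ℚ) (sumAll-cong n (λ s → f≈g (applySigns s u))))
          (sym (φ-eval g u)))

restrict00 : ∀ {m} → (Subset (suc (suc m)) → ℚ) → Subset m → ℚ
restrict00 c J = c (false ∷ false ∷ J)

β²-eval : ∀ {m} (c : Subset (suc (suc m)) → ℚ) → β² c ≈B Xcomb (restrict00 c)
β²-eval {m} c w = begin
  β² c w
    ≡⟨ sumOver≡sumAll (suc (suc m)) (λ _ → true) (λ J → c J * β²basis J w) ⟩
  sumAll (suc (suc m)) (λ J → c J * β²basis J w)
    ≡⟨ sumAll-suc² m (λ J → c J * β²basis J w) ⟩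
  (Σ00 + sumAll m (λ J → c (false ∷ true ∷ J) * 0ℚ))
    + (sumAll m (λ J → c (true ∷ false ∷ J) * 0ℚ) + sumAll m (λ J → c (true ∷ true ∷ J) * 0ℚ))
    ≡⟨ cong₂ _+_ (cong (Σ00 +_) (vanish false true)) (cong₂ _+_ (vanish true false) (vanish true true)) ⟩
  (Σ00 + 0ℚ) + (0ℚ + 0ℚ)
    ≡⟨ trans (+-identityʳ _) (+-identityʳ _) ⟩
  Σ00
    ≡⟨ Xcomb-eval (restrict00 c) w ⟨
  Xcomb (restrict00 c) w ∎
  where
  open ≡-Reasoning
  Σ00 = sumAll m (λ J → restrict00 c J * X J w)
  vanish : ∀ a b → sumAll m (λ J → c (a ∷ b ∷ J) * 0ℚ) ≡ 0ℚ
  vanish a b = sumAll-zero m (λ J → *-zeroʳ (c (a ∷ b ∷ J)))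

π-eval : ∀ {m} (d : Subset (suc (suc m)) → ℚ) u →
  π d u ≡ (if isPerm u then d (false ∷ false ∷ Peak u) - d (false ∷ true ∷ Peak u) else 0ℚ)
π-eval {m} d u = begin
  π d u
    ≡⟨ sumOver≡sumAll (suc (suc m)) inF (λ F → d F * πbasis F u) ⟩
  sumAll (suc (suc m)) (λ F → if inF F then d F * πbasis F u else 0ℚ)
    ≡⟨ sumAll-suc² m (λ F → if inF F then d F * πbasis F u else 0ℚ) ⟩
  (sumAll m (λ J → if noConsec (false ∷ J) then d (false ∷ false ∷ J) * (if head0 J then zeroA else P J) u else 0ℚ)
   + sumAll m (λ J → if noConsec (true ∷ J) then d (false ∷ true ∷ J) * (- P J u) else 0ℚ))
  + (sumAll m (λ _ → 0ℚ) + sumAll m (λ _ → 0ℚ))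
    ≡⟨ cong₂ _+_ (cong₂ _+_ peak-00 peak-01)
                 (cong₂ _+_ (sumAll-zero m (λ _ → refl)) (sumAll-zero m (λ _ → refl))) ⟩
  ((if b then d (false ∷ false ∷ G) else 0ℚ) + (if b then - d (false ∷ true ∷ G) else 0ℚ)) + (0ℚ + 0ℚ)
    ≡⟨ combine b ⟩
  (if b then d (false ∷ false ∷ G) - d (false ∷ true ∷ G) else 0ℚ) ∎
  where
  open ≡-Reasoning
  b = isPerm u
  G = Peak u

  guard-00 : ∀ nc h x (f : QA m) →
             (if nc then x * (if h then zeroA else f) u else 0ℚ) ≡ (if nc ∧ not h then x * f u else 0ℚ)
  guard-00 false h     x f = refl
  guard-00 true  true  x f = *-zeroʳ x
  guard-00 true  false x f = refl

  guard-01 : ∀ nc x y → (if nc then x * (- y) else 0ℚ) ≡ (if nc then (- x) * y else 0ℚ)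
  guard-01 false x y = refl
  guard-01 true  x y = solve 2 (λ x y → x :* (:- y) := (:- x) :* y) refl x y

  peak-00 : sumAll m (λ J → if noConsec (false ∷ J) then d (false ∷ false ∷ J) * (if head0 J then zeroA else P J) u else 0ℚ)
            ≡ (if b then d (false ∷ false ∷ G) else 0ℚ)
  peak-00 = trans (sumAll-cong m (λ J → guard-00 (noConsec (false ∷ J)) (head0 J) (d (false ∷ false ∷ J)) (P J)))
                  (sumAll-select m (λ J → noConsec (false ∷ J) ∧ not (head0 J)) (restrict00 d) b G
                    (cong₂ (λ nc h → nc ∧ not h) (trans (noConsec-false∷ G) (noConsec-Peak u)) (head0-Peak u)))

  peak-01 : sumAll m (λ J → if noConsec (true ∷ J) then d (false ∷ true ∷ J) * (- P J u) else 0ℚ)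
            ≡ (if b then - d (false ∷ true ∷ G) else 0ℚ)
  peak-01 = trans (sumAll-cong m (λ J → guard-01 (noConsec (true ∷ J)) (d (false ∷ true ∷ J)) (P J u)))
                  (sumAll-select m (λ J → noConsec (true ∷ J)) (λ J → - d (false ∷ true ∷ J)) b G
                                 (inF-false∷true∷Peak u))

  combine : ∀ b {p q} → ((if b then p else 0ℚ) + (if b then - q else 0ℚ)) + (0ℚ + 0ℚ) ≡ (if b then p - q else 0ℚ)
  combine true  = +-identityʳ _
  combine false = refl

elemℕ-false : ∀ {x} xs → All (x ≢_) xs → elemℕ x xs ≡ false
elemℕ-false []       []            = refl
elemℕ-false (y ∷ ys) (x≢y ∷ x∉ys) = cong₂ _∨_ (≡ᵇ-false x≢y) (elemℕ-false ys x∉ys)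

distinct-∷ : ∀ {x} xs → All (x ≢_) xs → distinct xs ≡ true → distinct (x ∷ xs) ≡ true
distinct-∷ xs x∉xs = cong₂ (λ e d → not e ∧ d) (elemℕ-false xs x∉xs)

inRange-intro : ∀ {N} xs → All (λ x → 1 ℕ.≤ x × x ℕ.≤ N) xs → inRange N xs ≡ true
inRange-intro []       []                  = refl
inRange-intro (x ∷ xs) ((1≤x , x≤N) ∷ ps) =
  cong₂ _∧_ (T⇒≡true (ℕ.≤⇒≤ᵇ 1≤x)) (cong₂ _∧_ (T⇒≡true (ℕ.≤⇒≤ᵇ x≤N)) (inRange-intro xs ps))

isPerm-intro : ∀ {n} (u : Vec ℕ n) → All (λ x → 1 ℕ.≤ x × x ℕ.≤ n) (V.toList u) →
               distinct (V.toList u) ≡ true → isPerm u ≡ true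
isPerm-intro u bounded = cong₂ _∧_ (inRange-intro (V.toList u) bounded)

withPeaks : ∀ {L} → ℕ → Vec Bool L → Vec ℕ (suc L)
withPeaks v []             = v ∷ []
withPeaks v (false ∷ F)     = v ∷ withPeaks (suc v) F
withPeaks v (true ∷ [])     = suc v ∷ v ∷ []
withPeaks v (true ∷ f ∷ F) = suc v ∷ v ∷ withPeaks (suc (suc v)) F

head-withPeaks : ∀ {L} v (F : Vec Bool L) → v ℕ.≤ V.head (withPeaks v F)
head-withPeaks v []             = ℕ.≤-refl
head-withPeaks v (false ∷ F)     = ℕ.≤-refl
head-withPeaks v (true ∷ [])     = ℕ.n≤1+n v
head-withPeaks v (true ∷ f ∷ F) = ℕ.n≤1+n v

withPeaks-bounds : ∀ {L} v (F : Vec Bool L) → All (λ x → v ℕ.≤ x × x ℕ.≤ v ℕ.+ L) (V.toList (withPeaks v F))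
withPeaks-bounds v [] = (ℕ.≤-refl , ℕ.m≤m+n v 0) ∷ []
withPeaks-bounds {suc L} v (false ∷ F) =
  (ℕ.≤-refl , ℕ.m≤m+n v (suc L)) ∷
  All.map (λ {x} (v<x , x≤) → ℕ.<⇒≤ v<x , subst (x ℕ.≤_) (sym (ℕ.+-suc v L)) x≤) (withPeaks-bounds (suc v) F)
withPeaks-bounds v (true ∷ []) = (ℕ.n≤1+n v , ℕ.≤-reflexive (ℕ.+-comm 1 v)) ∷ (ℕ.≤-refl , ℕ.m≤m+n v 1) ∷ []
withPeaks-bounds {suc (suc L)} v (true ∷ f ∷ F) =
  (ℕ.n≤1+n v , ℕ.≤-trans (ℕ.s≤s (ℕ.m≤m+n v (suc L))) (ℕ.≤-reflexive (sym (ℕ.+-suc v (suc L))))) ∷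
  (ℕ.≤-refl , ℕ.m≤m+n v (suc (suc L))) ∷
  All.map (λ {x} (v+2≤x , x≤) → ℕ.≤-trans (ℕ.m≤n+m v 2) v+2≤x ,
                                   subst (x ℕ.≤_) (sym (trans (ℕ.+-suc v (suc L)) (cong suc (ℕ.+-suc v L)))) x≤)
          (withPeaks-bounds (suc (suc v)) F)

withPeaks-distinct : ∀ {L} v (F : Vec Bool L) → distinct (V.toList (withPeaks v F)) ≡ true
withPeaks-distinct v [] = refl
withPeaks-distinct v (false ∷ F) =
  distinct-∷ _ (All.map (λ (v<x , _) → ℕ.<⇒≢ v<x) (withPeaks-bounds (suc v) F)) (withPeaks-distinct (suc v) F)
withPeaks-distinct v (true ∷ []) = distinct-∷ (v ∷ []) (ℕ.>⇒≢ (ℕ.n<1+n v) ∷ []) refl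
withPeaks-distinct v (true ∷ f ∷ F) =
  distinct-∷ _ (ℕ.>⇒≢ (ℕ.n<1+n v) ∷ All.map (λ (v+2≤x , _) → ℕ.<⇒≢ v+2≤x) rest-bounds)
    (distinct-∷ _ (All.map (λ (v+2≤x , _) → ℕ.<⇒≢ (ℕ.<-trans (ℕ.n<1+n v) v+2≤x)) rest-bounds)
                  (withPeaks-distinct (suc (suc v)) F))
  where rest-bounds = withPeaks-bounds (suc (suc v)) F

withPeaks-isPerm : ∀ {L} (F : Vec Bool L) → isPerm (withPeaks 1 F) ≡ true
withPeaks-isPerm {L} F = isPerm-intro (withPeaks 1 F) (withPeaks-bounds 1 F) (withPeaks-distinct 1 F)

peaksTail-∷ : ∀ {k} p x (v : Vec ℕ (suc k)) → peaksTail p (x ∷ v) ≡ ((p <ᵇ x) ∧ (V.head v <ᵇ x)) ∷ peaksTail x v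
peaksTail-∷ p x (y ∷ r) = refl

peaksTail-withPeaks : ∀ {L} p v (F : Vec Bool L) → p ℕ.< v → noConsec F ≡ true → peaksTail p (withPeaks v F) ≡ F
peaksTail-withPeaks p v []         p<v nc = refl
peaksTail-withPeaks p v (false ∷ F) p<v nc =
  trans (peaksTail-∷ p v (withPeaks (suc v) F))
        (cong₂ _∷_ (trans (cong ((p <ᵇ v) ∧_) (<ᵇ-false _ v (ℕ.<⇒≯ (head-withPeaks (suc v) F)))) (∧-zeroʳ (p <ᵇ v)))
                   (peaksTail-withPeaks v (suc v) F (ℕ.n<1+n v) (trans (sym (noConsec-false∷ F)) nc)))
peaksTail-withPeaks p v (true ∷ []) p<v nc = cong (_∷ []) (cong₂ _∧_ (<ᵇ-true (ℕ.m<n⇒m<1+n p<v)) (<ᵇ-true (ℕ.n<1+n v)))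
peaksTail-withPeaks p v (true ∷ false ∷ F) p<v nc =
  cong₂ _∷_ (cong₂ _∧_ (<ᵇ-true (ℕ.m<n⇒m<1+n p<v)) (<ᵇ-true (ℕ.n<1+n v)))
    (trans (peaksTail-∷ (suc v) v (withPeaks (suc (suc v)) F))
      (cong₂ _∷_ (cong (_∧ (V.head (withPeaks (suc (suc v)) F) <ᵇ v)) (<ᵇ-false (suc v) v (ℕ.<⇒≯ (ℕ.n<1+n v))))
                 (peaksTail-withPeaks v (suc (suc v)) F (ℕ.m<n⇒m<1+n (ℕ.n<1+n v)) (trans (sym (noConsec-false∷ F)) nc))))

Peak-nonempty : ∀ {k} (v : Vec ℕ (suc k)) → Peak v ≡ false ∷ peaksTail 0 v
Peak-nonempty (x ∷ r) = refl

Peak-realized : ∀ {n} (F : Subset n) → inF F ≡ true → ∃ λ u → isPerm u ≡ true × Peak u ≡ F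
Peak-realized []          _  = [] , refl , refl
Peak-realized (false ∷ F) nc =
  withPeaks 1 F , withPeaks-isPerm F ,
  trans (Peak-nonempty (withPeaks 1 F))
        (cong (false ∷_) (peaksTail-withPeaks 0 1 F ℕ.z<s (trans (sym (noConsec-false∷ F)) nc)))

∣sign∣ : ∀ s x → ∣ (if s then ℤ.- (ℤ.+ x) else ℤ.+ x) ∣ ≡ x
∣sign∣ false x       = refl
∣sign∣ true  zero    = refl
∣sign∣ true  (suc x) = refl

∣applySigns∣ : ∀ {n} (s : Subset n) (u : Vec ℕ n) → V.map ∣_∣ (applySigns s u) ≡ u
∣applySigns∣ []      []      = refl
∣applySigns∣ (b ∷ s) (x ∷ u) = cong₂ _∷_ (∣sign∣ b x) (∣applySigns∣ s u)

isSignedPerm-applySigns : ∀ {n} (s : Subset n) (u : Vec ℕ n) → isSignedPerm (applySigns s u) ≡ isPerm u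
isSignedPerm-applySigns s u = cong isPerm (∣applySigns∣ s u)

ascending : ℕ → (n : ℕ) → Vec ℕ n
ascending k zero    = []
ascending k (suc n) = k ∷ ascending (suc k) n

ascending-bounds : ∀ k n → All (λ x → k ℕ.≤ x × x ℕ.< k ℕ.+ n) (V.toList (ascending k n))
ascending-bounds k zero    = []
ascending-bounds k (suc n) = (ℕ.≤-refl , ℕ.m<m+n k ℕ.z<s) ∷
  All.map (λ {x} (k<x , x<) → ℕ.<⇒≤ k<x , subst (x ℕ.<_) (sym (ℕ.+-suc k n)) x<) (ascending-bounds (suc k) n)

ascending-distinct : ∀ k n → distinct (V.toList (ascending k n)) ≡ true
ascending-distinct k zero    = refl
ascending-distinct k (suc n) =
  distinct-∷ _ (All.map (λ (k<x , _) → ℕ.<⇒≢ k<x) (ascending-bounds (suc k) n)) (ascending-distinct (suc k) n)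

ascending-isPerm : ∀ n → isPerm (ascending 1 n) ≡ true
ascending-isPerm n = isPerm-intro (ascending 1 n)
  (All.map (λ (1≤x , x<1+n) → 1≤x , ℕ.≤-pred x<1+n) (ascending-bounds 1 n)) (ascending-distinct 1 n)

withDescents : ∀ {n} → Subset n → Vec ℤ n
withDescents {n} D = applySigns D (ascending 1 n)

sign>sign-suc : ∀ d b k → ((if b then ℤ.- (ℤ.+ k) else ℤ.+ k) >ℤ (if d then ℤ.- (ℤ.+ suc k) else ℤ.+ suc k)) ≡ d
sign>sign-suc false false k = trans (pos>pos k (suc k)) (<ᵇ-false (suc k) k (ℕ.<⇒≯ (ℕ.n<1+n k)))
sign>sign-suc false true  k = neg>pos k (suc k)
sign>sign-suc true  false k = pos>neg k (suc k) ℕ.z<s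
sign>sign-suc true  true  k = trans (neg>neg k (suc k)) (<ᵇ-true (ℕ.n<1+n k))

desFrom-withDescents : ∀ {n} (D : Subset n) b k →
  desFrom (if b then ℤ.- (ℤ.+ k) else ℤ.+ k) (applySigns D (ascending (suc k) n)) ≡ D
desFrom-withDescents []      b k = refl
desFrom-withDescents (d ∷ D) b k = cong₂ _∷_ (sign>sign-suc d b k) (desFrom-withDescents D d (suc k))

X-withDescents : ∀ {n} (J D : Subset n) → X J (withDescents D) ≡ ind (subSub D J)
X-withDescents {n} J D = trans (X-eval J (withDescents D))
  (cong₂ (λ p E → ind (p ∧ subSub E J))
         (trans (isSignedPerm-applySigns D (ascending 1 n)) (ascending-isPerm n))
         (desFrom-withDescents D false 0))

sumSupersets : ∀ {n} → (Subset n → ℚ) → Subset n → ℚ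
sumSupersets {n} c D = sumAll n (λ J → c J * ind (subSub D J))

sumSupersets-true∷ : ∀ {n} (c : Subset (suc n) → ℚ) D →
  sumSupersets c (true ∷ D) ≡ sumSupersets (λ J → c (true ∷ J)) D
sumSupersets-true∷ {n} c D =
  trans (sumAll-suc n (λ J → c J * ind (subSub (true ∷ D) J)))
        (trans (cong (_+ sumSupersets (λ J → c (true ∷ J)) D) (sumAll-zero n (λ J → *-zeroʳ (c (false ∷ J)))))
               (+-identityˡ _))

sumSupersets-injective : ∀ {n} (c e : Subset n → ℚ) →
  (∀ D → sumSupersets c D ≡ sumSupersets e D) → ∀ J → c J ≡ e J
sumSupersets-injective {zero} c e c≈e [] =
  trans (sym (*-identityʳ (c [])))
   (trans (sym (sumAll-[] (λ J → c J * ind (subSub [] J))))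
    (trans (c≈e []) (trans (sumAll-[] (λ J → e J * ind (subSub [] J))) (*-identityʳ (e [])))))
sumSupersets-injective {suc n} c e c≈e = agree
  where
  c₀ e₀ c₁ e₁ : Subset n → ℚ
  c₀ J = c (false ∷ J)
  e₀ J = e (false ∷ J)
  c₁ J = c (true ∷ J)
  e₁ J = e (true ∷ J)
  agree₁ : ∀ J → c₁ J ≡ e₁ J
  agree₁ = sumSupersets-injective c₁ e₁ λ D →
    trans (sym (sumSupersets-true∷ c D)) (trans (c≈e (true ∷ D)) (sumSupersets-true∷ e D))
  agree₀ : ∀ J → c₀ J ≡ e₀ J
  agree₀ = sumSupersets-injective c₀ e₀ λ D → ∙-cancelʳ (sumSupersets e₁ D) _ _
    (trans (cong (sumSupersets c₀ D +_) (sumAll-cong n (λ J → cong (_* ind (subSub D J)) (sym (agree₁ J)))))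
      (trans (sym (sumAll-suc n _)) (trans (c≈e (false ∷ D)) (sumAll-suc n _))))
  agree : ∀ J → c J ≡ e J
  agree (false ∷ J) = agree₀ J
  agree (true ∷ J)  = agree₁ J

Xcomb-injective : ∀ {n} (c e : Subset n → ℚ) → Xcomb c ≈B Xcomb e → ∀ J → c J ≡ e J
Xcomb-injective {n} c e c≈e = sumSupersets-injective c e λ D →
  trans (sym (Xcomb-withDescents c D)) (trans (c≈e (withDescents D)) (Xcomb-withDescents e D))
  where
  Xcomb-withDescents : ∀ c D → Xcomb c (withDescents D) ≡ sumSupersets c D
  Xcomb-withDescents c D = trans (Xcomb-eval c (withDescents D))
                                 (sumAll-cong n (λ J → cong (c J *_) (X-withDescents J D)))

two : ℚ
two = 1ℚ + 1ℚ

pow2 : Bool → ℚ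
pow2 j = if j then two else 1ℚ

peakWeight : ∀ {n} → Bool → Subset n → Subset n → ℚ
peakWeight p []      []      = 1ℚ
peakWeight p (f ∷ F) (j ∷ J) = if not f ∨ p ∨ j then pow2 j * peakWeight j F J else 0ℚ

peakCoeff : ∀ n → Bool → (Subset n → ℚ) → Subset n → ℚ
peakCoeff n p c F = sumAll n (λ J → c J * peakWeight p F J)

signCount : ∀ {k} → ℤ → Vec ℕ k → Subset k → ℚ
signCount {k} p u J = sumAll k (λ s → ind (subSub (desFrom p (applySigns s u)) J))

signCount-∷ : ∀ {k} p x (u : Vec ℕ k) j J →
  signCount p (x ∷ u) (j ∷ J) ≡ ind (not (p >ℤ (ℤ.+ x)) ∨ j) * signCount (ℤ.+ x) u J
                               + ind (not (p >ℤ (ℤ.- (ℤ.+ x))) ∨ j) * signCount (ℤ.- (ℤ.+ x)) u J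
signCount-∷ {k} p x u j J =
  trans (sumAll-suc k (λ s → ind (subSub (desFrom p (applySigns s (x ∷ u))) (j ∷ J))))
        (cong₂ _+_ (factor (ℤ.+ x)) (factor (ℤ.- (ℤ.+ x))))
  where
  factor : ∀ q → sumAll k (λ s → ind ((not (p >ℤ q) ∨ j) ∧ subSub (desFrom q (applySigns s u)) J))
                 ≡ ind (not (p >ℤ q) ∨ j) * signCount q u J
  factor q = trans (sumAll-cong k (λ s → ind-∧ (not (p >ℤ q) ∨ j) _))
                   (sumAll-* k (ind (not (p >ℤ q) ∨ j)) _)

NonRepeating : ∀ {k} → ℕ → Vec ℕ k → Set
NonRepeating y []      = ⊤
NonRepeating y (z ∷ u) = 1 ℕ.≤ z × y ≢ z × NonRepeating z u

-- The counts after +y and after -y are proved together, since each step refers to both signs of z.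
tailWeight : ∀ {k} → ℕ → Vec ℕ k → Subset k → ℚ
tailWeight y []      []      = 1ℚ
tailWeight y (z ∷ u) (j ∷ J) = pow2 j * peakWeight j (peaksTail y (z ∷ u)) J

posCount : ∀ {k} → ℕ → Vec ℕ k → Subset k → ℚ
posCount y []      []      = 1ℚ
posCount y (z ∷ u) (j ∷ J) = ind (not (z <ᵇ y) ∨ j) * tailWeight y (z ∷ u) (j ∷ J)

negCount : ∀ {k} → ℕ → Vec ℕ k → Subset k → ℚ
negCount y []      []      = 1ℚ
negCount y (z ∷ u) (j ∷ J) = (if (z <ᵇ y) ∧ not j then two else 1ℚ) * tailWeight y (z ∷ u) (j ∷ J)

posStep-table : ∀ a a' b j j' → a' ≡ not a →
  ind (not a ∨ j) * ind (not b ∨ j') + ind j * (if b ∧ not j' then two else 1ℚ)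
  ≡ ind (not a ∨ j) * pow2 j * ind (not (a' ∧ b) ∨ j ∨ j')
posStep-table true  .false true  true  true  refl = refl
posStep-table true  .false true  true  false refl = refl
posStep-table true  .false true  false true  refl = refl
posStep-table true  .false true  false false refl = refl
posStep-table true  .false false true  true  refl = refl
posStep-table true  .false false true  false refl = refl
posStep-table true  .false false false true  refl = refl
posStep-table true  .false false false false refl = refl
posStep-table false .true  true  true  true  refl = refl
posStep-table false .true  true  true  false refl = refl
posStep-table false .true  true  false true  refl = refl
posStep-table false .true  true  false false refl = refl
posStep-table false .true  false true  true  refl = refl
posStep-table false .true  false true  false refl = refl
posStep-table false .true  false false true  refl = refl
posStep-table false .true  false false false refl = refl

negStep-table : ∀ a a' b j j' → a' ≡ not a →
  ind true * ind (not b ∨ j') + ind (not a' ∨ j) * (if b ∧ not j' then two else 1ℚ)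
  ≡ (if a ∧ not j then two else 1ℚ) * pow2 j * ind (not (a' ∧ b) ∨ j ∨ j')
negStep-table true  .false true  true  true  refl = refl
negStep-table true  .false true  true  false refl = refl
negStep-table true  .false true  false true  refl = refl
negStep-table true  .false true  false false refl = refl
negStep-table true  .false false true  true  refl = refl
negStep-table true  .false false true  false refl = refl
negStep-table true  .false false false true  refl = refl
negStep-table true  .false false false false refl = refl
negStep-table false .true  true  true  true  refl = refl
negStep-table false .true  true  true  false refl = refl
negStep-table false .true  true  false true  refl = refl
negStep-table false .true  true  false false refl = refl
negStep-table false .true  false true  true  refl = refl
negStep-table false .true  false true  false refl = refl
negStep-table false .true  false false true  refl = refl
negStep-table false .true  false false false refl = refl

posStep-last-table : ∀ a j → ind (not a ∨ j) * 1ℚ + ind j * 1ℚ ≡ ind (not a ∨ j) * (pow2 j * 1ℚ)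
posStep-last-table true  true  = refl
posStep-last-table true  false = refl
posStep-last-table false true  = refl
posStep-last-table false false = refl

negStep-last-table : ∀ a a' j → a' ≡ not a →
  ind true * 1ℚ + ind (not a' ∨ j) * 1ℚ ≡ (if a ∧ not j then two else 1ℚ) * (pow2 j * 1ℚ)
negStep-last-table true  .false true  refl = refl
negStep-last-table true  .false false refl = refl
negStep-last-table false .true  true  refl = refl
negStep-last-table false .true  false refl = refl

factor-common : ∀ a b c d e f t M → a * b + c * d ≡ e * f * ind t →
  a * (b * M) + c * (d * M) ≡ e * (f * (if t then M else 0ℚ))
factor-common a b c d e f t M coeffs = begin
  a * (b * M) + c * (d * M)
    ≡⟨ solve 5 (λ a b c d M → a :* (b :* M) :+ c :* (d :* M) := (a :* b :+ c :* d) :* M) refl a b c d M ⟩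
  (a * b + c * d) * M
    ≡⟨ cong (_* M) coeffs ⟩
  (e * f * ind t) * M
    ≡⟨ solve 4 (λ e f i M → e :* (f :* (i :* M)) := (e :* f :* i) :* M) refl e f (ind t) M ⟨
  e * (f * (ind t * M))
    ≡⟨ cong (λ x → e * (f * x)) (if-else-0≡ind* t M) ⟨
  e * (f * (if t then M else 0ℚ)) ∎
  where open ≡-Reasoning

posCount-∷ : ∀ {k} y z (u : Vec ℕ k) j J → y ≢ z →
  ind (not (z <ᵇ y) ∨ j) * posCount z u J + ind j * negCount z u J ≡ posCount y (z ∷ u) (j ∷ J)
posCount-∷ y z []      j []       _   = posStep-last-table (z <ᵇ y) j
posCount-∷ y z (x ∷ u) j (j' ∷ J) y≢z =
  factor-common (ind (not (z <ᵇ y) ∨ j)) (ind (not (x <ᵇ z) ∨ j')) (ind j) (if (x <ᵇ z) ∧ not j' then two else 1ℚ)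
                (ind (not (z <ᵇ y) ∨ j)) (pow2 j)
                (not ((y <ᵇ z) ∧ (x <ᵇ z)) ∨ j ∨ j') (tailWeight z (x ∷ u) (j' ∷ J))
    (posStep-table (z <ᵇ y) (y <ᵇ z) (x <ᵇ z) j j' (<ᵇ-flip y z y≢z))

negCount-∷ : ∀ {k} y z (u : Vec ℕ k) j J → y ≢ z →
  ind true * posCount z u J + ind (not (y <ᵇ z) ∨ j) * negCount z u J ≡ negCount y (z ∷ u) (j ∷ J)
negCount-∷ y z []      j []       y≢z = negStep-last-table (z <ᵇ y) (y <ᵇ z) j (<ᵇ-flip y z y≢z)
negCount-∷ y z (x ∷ u) j (j' ∷ J) y≢z =
  factor-common (ind true) (ind (not (x <ᵇ z) ∨ j')) (ind (not (y <ᵇ z) ∨ j)) (if (x <ᵇ z) ∧ not j' then two else 1ℚ)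
                (if (z <ᵇ y) ∧ not j then two else 1ℚ) (pow2 j)
                (not ((y <ᵇ z) ∧ (x <ᵇ z)) ∨ j ∨ j') (tailWeight z (x ∷ u) (j' ∷ J))
    (negStep-table (z <ᵇ y) (y <ᵇ z) (x <ᵇ z) j j' (<ᵇ-flip y z y≢z))

signCount-closed : ∀ {k} y (u : Vec ℕ k) J → NonRepeating y u →
  signCount (ℤ.+ y) u J ≡ posCount y u J × signCount (ℤ.- (ℤ.+ y)) u J ≡ negCount y u J
signCount-closed y []      []      _ =
  sumAll-[] (λ s → ind (subSub (desFrom (ℤ.+ y) (applySigns s [])) [])) ,
  sumAll-[] (λ s → ind (subSub (desFrom (ℤ.- (ℤ.+ y)) (applySigns s [])) []))
signCount-closed y (z ∷ u) (j ∷ J) (1≤z , y≢z , z∷u-nonRepeating) = pos , neg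
  where
  open ≡-Reasoning
  s⁺ = signCount (ℤ.+ z) u J
  s⁻ = signCount (ℤ.- (ℤ.+ z)) u J
  ih = signCount-closed z u J z∷u-nonRepeating

  pos : signCount (ℤ.+ y) (z ∷ u) (j ∷ J) ≡ posCount y (z ∷ u) (j ∷ J)
  pos = begin
    signCount (ℤ.+ y) (z ∷ u) (j ∷ J)
      ≡⟨ signCount-∷ (ℤ.+ y) z u j J ⟩
    ind (not ((ℤ.+ y) >ℤ (ℤ.+ z)) ∨ j) * s⁺ + ind (not ((ℤ.+ y) >ℤ (ℤ.- (ℤ.+ z))) ∨ j) * s⁻
      ≡⟨ cong₂ (λ A B → ind (not A ∨ j) * s⁺ + ind (not B ∨ j) * s⁻) (pos>pos y z) (pos>neg y z 1≤z) ⟩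
    ind (not (z <ᵇ y) ∨ j) * s⁺ + ind j * s⁻
      ≡⟨ cong₂ (λ p n → ind (not (z <ᵇ y) ∨ j) * p + ind j * n) (proj₁ ih) (proj₂ ih) ⟩
    ind (not (z <ᵇ y) ∨ j) * posCount z u J + ind j * negCount z u J
      ≡⟨ posCount-∷ y z u j J y≢z ⟩
    posCount y (z ∷ u) (j ∷ J) ∎

  neg : signCount (ℤ.- (ℤ.+ y)) (z ∷ u) (j ∷ J) ≡ negCount y (z ∷ u) (j ∷ J)
  neg = begin
    signCount (ℤ.- (ℤ.+ y)) (z ∷ u) (j ∷ J)
      ≡⟨ signCount-∷ (ℤ.- (ℤ.+ y)) z u j J ⟩
    ind (not ((ℤ.- (ℤ.+ y)) >ℤ (ℤ.+ z)) ∨ j) * s⁺ + ind (not ((ℤ.- (ℤ.+ y)) >ℤ (ℤ.- (ℤ.+ z))) ∨ j) * s⁻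
      ≡⟨ cong₂ (λ A B → ind (not A ∨ j) * s⁺ + ind (not B ∨ j) * s⁻) (neg>pos y z) (neg>neg y z) ⟩
    ind true * s⁺ + ind (not (y <ᵇ z) ∨ j) * s⁻
      ≡⟨ cong₂ (λ p n → ind true * p + ind (not (y <ᵇ z) ∨ j) * n) (proj₁ ih) (proj₂ ih) ⟩
    ind true * posCount z u J + ind (not (y <ᵇ z) ∨ j) * negCount z u J
      ≡⟨ negCount-∷ y z u j J y≢z ⟩
    negCount y (z ∷ u) (j ∷ J) ∎

signCount-peakWeight : ∀ {n} (u : Vec ℕ n) J → NonRepeating 0 u → signCount (ℤ.+ 0) u J ≡ peakWeight false (Peak u) J
signCount-peakWeight []      []      nr = proj₁ (signCount-closed 0 [] [] nr)
signCount-peakWeight (x ∷ u) (j ∷ J) nr = trans (proj₁ (signCount-closed 0 (x ∷ u) (j ∷ J) nr)) (*-identityˡ _)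

inRange-head : ∀ {N} x xs → inRange N (x ∷ xs) ≡ true → 1 ℕ.≤ x
inRange-head {N} x xs in-range = ℕ.≤ᵇ⇒≤ 1 x (≡true⇒T (∧-conicalˡ (1 ≤ᵇ x) _ in-range))

inRange-tail : ∀ {N} x xs → inRange N (x ∷ xs) ≡ true → inRange N xs ≡ true
inRange-tail {N} x xs in-range = ∧-conicalʳ (x ≤ᵇ N) _ (∧-conicalʳ (1 ≤ᵇ x) _ in-range)

distinct-tail : ∀ x xs → distinct (x ∷ xs) ≡ true → distinct xs ≡ true
distinct-tail x xs = ∧-conicalʳ (not (elemℕ x xs)) _

distinct-head : ∀ x y ys → distinct (x ∷ y ∷ ys) ≡ true → x ≢ y
distinct-head x .x ys all-distinct refl
  with () ← trans (cong (λ b → not (b ∨ elemℕ x ys)) (sym (T⇒≡true (ℕ.≡⇒≡ᵇ x x refl))))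
                  (∧-conicalˡ (not (elemℕ x (x ∷ ys))) _ all-distinct)

nonRepeating : ∀ {N} z {k} (u : Vec ℕ k) → inRange N (V.toList u) ≡ true →
               distinct (V.toList (z ∷ u)) ≡ true → NonRepeating z u
nonRepeating z []      _        _            = tt
nonRepeating z (x ∷ u) in-range all-distinct =
  inRange-head x (V.toList u) in-range , distinct-head z x (V.toList u) all-distinct ,
  nonRepeating x u (inRange-tail x (V.toList u) in-range) (distinct-tail z (V.toList (x ∷ u)) all-distinct)

isPerm⇒NonRepeating : ∀ {n} (u : Vec ℕ n) → isPerm u ≡ true → NonRepeating 0 u
isPerm⇒NonRepeating []      _    = tt
isPerm⇒NonRepeating (z ∷ u) perm =
  1≤z , ℕ.<⇒≢ 1≤z , nonRepeating z u (inRange-tail z (V.toList u) in-range) (∧-conicalʳ (inRange _ (z ∷ V.toList u)) _ perm)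
  where
  in-range = ∧-conicalˡ (inRange _ (z ∷ V.toList u)) _ perm
  1≤z = inRange-head z (V.toList u) in-range

φ-X : ∀ {n} (J : Subset n) u → isPerm u ≡ true →
  sumAll n (λ s → X J (applySigns s u)) ≡ peakWeight false (Peak u) J
φ-X {n} J u perm =
  trans (sumAll-cong n (λ s → trans (X-eval J (applySigns s u))
                                    (cong (λ b → ind (b ∧ subSub (Des (applySigns s u)) J))
                                          (trans (isSignedPerm-applySigns s u) perm))))
        (signCount-peakWeight u J (isPerm⇒NonRepeating u perm))

φ-Xcomb : ∀ {n} (c : Subset n → ℚ) → φ (Xcomb c) ≈A Pcomb (peakCoeff n false c)
φ-Xcomb {n} c u = begin
  φ (Xcomb c) u
    ≡⟨ φ-eval (Xcomb c) u ⟩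
  (if isPerm u then sumAll n (λ s → Xcomb c (applySigns s u)) else 0ℚ)
    ≡⟨ if-else-0-cong (isPerm u) expand ⟩
  (if isPerm u then peakCoeff n false c (Peak u) else 0ℚ)
    ≡⟨ Pcomb-eval (peakCoeff n false c) u ⟨
  Pcomb (peakCoeff n false c) u ∎
  where
  open ≡-Reasoning
  expand : isPerm u ≡ true → sumAll n (λ s → Xcomb c (applySigns s u)) ≡ peakCoeff n false c (Peak u)
  expand perm = begin
    sumAll n (λ s → Xcomb c (applySigns s u))
      ≡⟨ sumAll-cong n (λ s → Xcomb-eval c (applySigns s u)) ⟩
    sumAll n (λ s → sumAll n (λ J → c J * X J (applySigns s u)))
      ≡⟨ sumAll-swap n n (λ s J → c J * X J (applySigns s u)) ⟩
    sumAll n (λ J → sumAll n (λ s → c J * X J (applySigns s u)))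
      ≡⟨ sumAll-cong n (λ J → sumAll-* n (c J) (λ s → X J (applySigns s u))) ⟩
    sumAll n (λ J → c J * sumAll n (λ s → X J (applySigns s u)))
      ≡⟨ sumAll-cong n (λ J → cong (c J *_) (φ-X J u perm)) ⟩
    peakCoeff n false c (Peak u) ∎

peakCoeff-[] : ∀ p (c : Subset 0 → ℚ) → peakCoeff 0 p c [] ≡ c []
peakCoeff-[] p c = trans (sumAll-[] (λ J → c J * peakWeight p [] J)) (*-identityʳ (c []))

peakWeight-∷true : ∀ {n} p f (F J : Subset n) → peakWeight p (f ∷ F) (true ∷ J) ≡ two * peakWeight true F J
peakWeight-∷true p     false F J = refl
peakWeight-∷true false true  F J = refl
peakWeight-∷true true  true  F J = refl

peakCoeff-∷ : ∀ n p f (c : Subset (suc n) → ℚ) F →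
  peakCoeff (suc n) p c (f ∷ F) ≡ (if not f ∨ p then peakCoeff n false (λ J → c (false ∷ J)) F else 0ℚ)
                                  + two * peakCoeff n true (λ J → c (true ∷ J)) F
peakCoeff-∷ n p f c F = trans (sumAll-suc n (λ J → c J * peakWeight p (f ∷ F) J)) (cong₂ _+_ (J₀∉ p f) J₀∈)
  where
  J₀∉ : ∀ p f → sumAll n (λ J → c (false ∷ J) * peakWeight p (f ∷ F) (false ∷ J))
                ≡ (if not f ∨ p then peakCoeff n false (λ J → c (false ∷ J)) F else 0ℚ)
  J₀∉ p     false = sumAll-cong n (λ J → cong (c (false ∷ J) *_) (*-identityˡ _))
  J₀∉ true  true  = sumAll-cong n (λ J → cong (c (false ∷ J) *_) (*-identityˡ _))
  J₀∉ false true  = sumAll-zero n (λ J → *-zeroʳ (c (false ∷ J)))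

  J₀∈ : sumAll n (λ J → c (true ∷ J) * peakWeight p (f ∷ F) (true ∷ J)) ≡ two * peakCoeff n true (λ J → c (true ∷ J)) F
  J₀∈ = trans (sumAll-cong n (λ J → trans (cong (c (true ∷ J) *_) (peakWeight-∷true p f F J))
                                          (*-leftSwap (c (true ∷ J)) two _)))
              (sumAll-* n two (λ J → c (true ∷ J) * peakWeight true F J))

zeroHead : ∀ {n} → Subset n → Subset n
zeroHead []      = []
zeroHead (b ∷ F) = false ∷ F

byHead : ∀ {n} → (Subset n → ℚ) → (Subset n → ℚ) → Subset (suc n) → ℚ
byHead c₀ c₁ (false ∷ J) = c₀ J
byHead c₀ c₁ (true ∷ J)  = c₁ J

two*½ : ∀ x → two * (½ * x) ≡ x
two*½ x = trans (sym (*-assoc two ½ x)) (*-identityˡ x)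

peakCoeff-solve : ∀ n (g : Subset n → ℚ) → ∃ λ c → ∀ F → noConsec F ≡ true → peakCoeff n false c F ≡ g F
-- When the index before F's first one lies in J, F's first entry imposes no condition,
-- so only zeroHead F can be prescribed.
peakCoeff-solve-after∈ : ∀ n (g : Subset n → ℚ) →
  ∃ λ c → ∀ F → noConsec F ≡ true → peakCoeff n true c F ≡ g (zeroHead F)

peakCoeff-solve zero    g = g , λ { [] _ → peakCoeff-[] false g }
peakCoeff-solve (suc n) g = byHead c₀ c₁ , solves
  where
  solution₁ = peakCoeff-solve-after∈ n (λ F → ½ * g (true ∷ F))
  c₁ = proj₁ solution₁
  solution₀ = peakCoeff-solve n (λ F → g (false ∷ F) - two * peakCoeff n true c₁ F)
  c₀ = proj₁ solution₀
  solves : ∀ F → noConsec F ≡ true → peakCoeff (suc n) false (byHead c₀ c₁) F ≡ g F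
  solves (false ∷ F) nc =
    trans (peakCoeff-∷ n false false (byHead c₀ c₁) F)
     (trans (cong (_+ two * peakCoeff n true c₁ F) (proj₂ solution₀ F (noConsec-∷ false F nc)))
            (//-rightDividesˡ (two * peakCoeff n true c₁ F) (g (false ∷ F))))
  solves (true ∷ F) nc =
    trans (peakCoeff-∷ n false true (byHead c₀ c₁) F)
     (trans (+-identityˡ _)
      (trans (cong (two *_) (proj₂ solution₁ F (noConsec-∷ true F nc)))
       (trans (two*½ _) (cong (λ K → g (true ∷ K)) (zeroHead-after∈ F nc)))))
    where
    zeroHead-after∈ : ∀ {n} (F : Subset n) → noConsec (true ∷ F) ≡ true → zeroHead F ≡ F
    zeroHead-after∈ []          _ = refl
    zeroHead-after∈ (false ∷ F) _ = refl

peakCoeff-solve-after∈ zero    g = g , λ { [] _ → peakCoeff-[] true g }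
peakCoeff-solve-after∈ (suc n) g = byHead c₀ (λ _ → 0ℚ) , solves
  where
  solution₀ = peakCoeff-solve n (λ F → g (false ∷ F))
  c₀ = proj₁ solution₀
  solves : ∀ F → noConsec F ≡ true → peakCoeff (suc n) true (byHead c₀ (λ _ → 0ℚ)) F ≡ g (zeroHead F)
  solves (f ∷ F) nc =
    trans (peakCoeff-∷ n true f (byHead c₀ (λ _ → 0ℚ)) F)
     (trans (cong₂ _+_ (cong (λ b → if b then peakCoeff n false c₀ F else 0ℚ) (∨-zeroʳ (not f)))
                       (trans (cong (two *_) (sumAll-zero n (λ J → *-zeroˡ (peakWeight true F J)))) (*-zeroʳ two)))
      (trans (+-identityʳ _) (proj₂ solution₀ F (noConsec-∷ f F nc))))

peakWeight-00-01 : ∀ {m} (G : Subset m) a b J →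
  peakWeight false (false ∷ false ∷ G) (a ∷ b ∷ J) - peakWeight false (false ∷ true ∷ G) (a ∷ b ∷ J)
  ≡ (if a ∨ b then 0ℚ else peakWeight false G J)
peakWeight-00-01 G false false J = trans (+-identityʳ _) (trans (*-identityˡ _) (*-identityˡ _))
peakWeight-00-01 G false true  J = +-inverseʳ (peakWeight false (false ∷ false ∷ G) (false ∷ true ∷ J))
peakWeight-00-01 G true  b     J = +-inverseʳ (peakWeight false (false ∷ false ∷ G) (true ∷ b ∷ J))

peakCoeff-00-01 : ∀ {m} (c : Subset (suc (suc m)) → ℚ) G →
  peakCoeff (suc (suc m)) false c (false ∷ false ∷ G) - peakCoeff (suc (suc m)) false c (false ∷ true ∷ G)
  ≡ peakCoeff m false (restrict00 c) G
peakCoeff-00-01 {m} c G = begin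
  peakCoeff (suc (suc m)) false c (false ∷ false ∷ G) - peakCoeff (suc (suc m)) false c (false ∷ true ∷ G)
    ≡⟨ sumAll-sub (suc (suc m)) (λ J → c J * peakWeight false (false ∷ false ∷ G) J) _ ⟨
  sumAll (suc (suc m)) (λ J → c J * peakWeight false (false ∷ false ∷ G) J - c J * peakWeight false (false ∷ true ∷ G) J)
    ≡⟨ sumAll-cong (suc (suc m)) difference ⟩
  sumAll (suc (suc m)) (λ J → c J * ifNot01 J)
    ≡⟨ sumAll-suc² m (λ J → c J * ifNot01 J) ⟩
  (peakCoeff m false (restrict00 c) G + vanishing false true) + (vanishing true false + vanishing true true)
    ≡⟨ cong₂ _+_ (cong (peakCoeff m false (restrict00 c) G +_) (vanish false true))
                 (cong₂ _+_ (vanish true false) (vanish true true)) ⟩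
  (peakCoeff m false (restrict00 c) G + 0ℚ) + (0ℚ + 0ℚ)
    ≡⟨ trans (+-identityʳ _) (+-identityʳ _) ⟩
  peakCoeff m false (restrict00 c) G ∎
  where
  open ≡-Reasoning
  ifNot01 : Subset (suc (suc m)) → ℚ
  ifNot01 (a ∷ b ∷ J) = if a ∨ b then 0ℚ else peakWeight false G J
  difference : ∀ J → c J * peakWeight false (false ∷ false ∷ G) J - c J * peakWeight false (false ∷ true ∷ G) J
                     ≡ c J * ifNot01 J
  difference J@(a ∷ b ∷ J') =
    trans (solve 3 (λ c x y → c :* x :- c :* y := c :* (x :- y)) refl (c J) _ _) (cong (c J *_) (peakWeight-00-01 G a b J'))
  vanishing : Bool → Bool → ℚ
  vanishing a b = sumAll m (λ J → c (a ∷ b ∷ J) * 0ℚ)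
  vanish : ∀ a b → vanishing a b ≡ 0ℚ
  vanish a b = sumAll-zero m (λ J → *-zeroʳ (c (a ∷ b ∷ J)))

peakCoeff-remove1 : ∀ {m} (e : Subset (suc (suc m)) → ℚ) → (∀ J → has01 J ≡ false → e J ≡ 0ℚ) →
  ∀ F → peakCoeff (suc (suc m)) false e F ≡ peakCoeff (suc (suc m)) false e (remove1 F)
peakCoeff-remove1 {m} e e-I01 (f₀ ∷ f₁ ∷ F) = sumAll-cong (suc (suc m)) (termwise f₁)
  where
  termwise : ∀ f₁ J → e J * peakWeight false (f₀ ∷ f₁ ∷ F) J ≡ e J * peakWeight false (f₀ ∷ false ∷ F) J
  termwise f₁    J@(false ∷ false ∷ _) = *-cong-zeroˡ (e-I01 J refl)
  termwise true  (false ∷ true ∷ J) = refl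
  termwise false (false ∷ true ∷ J) = refl
  termwise true  (true ∷ b ∷ J)     = refl
  termwise false (true ∷ b ∷ J)     = refl

only10 : ∀ {m} → (Subset m → ℚ) → Subset (suc (suc m)) → ℚ
only10 c (true ∷ false ∷ J) = c J
only10 c _                  = 0ℚ

peakCoeff-only10 : ∀ {m} (c : Subset m → ℚ) F f₁ →
  peakCoeff (suc (suc m)) false (only10 c) (false ∷ f₁ ∷ F) ≡ two * peakCoeff m false c F
peakCoeff-only10 {m} c F f₁ =
  trans (sumAll-suc² m (λ J → only10 c J * peakWeight false (false ∷ f₁ ∷ F) J))
   (trans (cong₂ _+_ (cong₂ _+_ (vanish false false) (vanish false true)) (cong₂ _+_ at10 (vanish true true)))
    (trans (+-identityˡ _) (+-identityʳ _)))
  where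
  vanish : ∀ a b → sumAll m (λ J → 0ℚ * peakWeight false (false ∷ f₁ ∷ F) (a ∷ b ∷ J)) ≡ 0ℚ
  vanish a b = sumAll-zero m (λ J → *-zeroˡ (peakWeight false (false ∷ f₁ ∷ F) (a ∷ b ∷ J)))
  at10 : sumAll m (λ J → c J * peakWeight false (false ∷ f₁ ∷ F) (true ∷ false ∷ J)) ≡ two * peakCoeff m false c F
  at10 = trans (sumAll-cong m (λ J → cong (c J *_) (weight f₁ J)))
               (trans (sumAll-cong m (λ J → *-leftSwap (c J) two _))
                      (sumAll-* m two (λ J → c J * peakWeight false F J)))
    where
    weight : ∀ f₁ J → peakWeight false (false ∷ f₁ ∷ F) (true ∷ false ∷ J) ≡ two * peakWeight false F J
    weight true  J = cong (two *_) (*-identityˡ (peakWeight false F J))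
    weight false J = cong (two *_) (*-identityˡ (peakWeight false F J))

inF⇒noConsec : ∀ {n} (F : Subset n) → inF F ≡ true → noConsec F ≡ true
inF⇒noConsec F = ∧-conicalʳ (not (head0 F)) (noConsec F)

Pcomb-cong : ∀ {n} (d d' : Subset n → ℚ) → (∀ F → inF F ≡ true → d F ≡ d' F) → Pcomb d ≈A Pcomb d'
Pcomb-cong d d' d≗d' u =
  trans (Pcomb-eval d u) (trans (if-else-0-cong (isPerm u) (λ _ → d≗d' (Peak u) (Peak-inF u))) (sym (Pcomb-eval d' u)))

Pcomb-injective : ∀ {n} (d d' : Subset n → ℚ) → Pcomb d ≈A Pcomb d' → ∀ F → inF F ≡ true → d F ≡ d' F
Pcomb-injective d d' d≈d' F F∈𝓕 with u , perm , Peak-u≡F ← Peak-realized F F∈𝓕 =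
  trans (sym (at-u d)) (trans (d≈d' u) (at-u d'))
  where
  at-u : ∀ d → Pcomb d u ≡ d F
  at-u d = trans (Pcomb-eval d u) (cong₂ (λ b K → if b then d K else 0ℚ) perm Peak-u≡F)

P°comb≈Pcomb : ∀ {n} (e : Subset n → ℚ) → P°comb e ≈A Pcomb (λ F → e (remove1 F))
P°comb≈Pcomb e u = trans (P°comb-eval e u) (sym (Pcomb-eval (λ F → e (remove1 F)) u))

Xcomb-zero : ∀ {n} {c : Subset n → ℚ} → (∀ J → c J ≡ 0ℚ) → Xcomb c ≈B zeroB
Xcomb-zero {n} {c} c≗0 w = trans (Xcomb-eval c w) (sumAll-zero n (λ J → trans (cong (_* X J w) (c≗0 J)) (*-zeroˡ (X J w))))

liftAt00 : ∀ {m} → (Subset m → ℚ) → Subset (suc (suc m)) → ℚ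
liftAt00 c (a ∷ b ∷ J) = if a ∨ b then 0ℚ else c J

π-liftAt00 : ∀ {m} (d : Subset m → ℚ) → π (liftAt00 d) ≈A Pcomb d
π-liftAt00 d u = trans (π-eval (liftAt00 d) u)
  (trans (if-else-0-cong (isPerm u) (λ _ → +-identityʳ (d (Peak u)))) (sym (Pcomb-eval d u)))

β²≈0⇒InI01 : ∀ {m} (c : Subset (suc (suc m)) → ℚ) → β² c ≈B zeroB → InI01 (Xcomb c)
β²≈0⇒InI01 {m} c β²c≈0 = c , vanish , λ _ → refl
  where
  vanish : ∀ J → has01 J ≡ false → c J ≡ 0ℚ
  vanish (false ∷ false ∷ J) _ =
    Xcomb-injective (restrict00 c) (λ _ → 0ℚ)
      (λ w → trans (sym (β²-eval c w)) (trans (β²c≈0 w) (sym (Xcomb-zero (λ _ → refl) w)))) J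

InI01⇒β²≈0 : ∀ {m} (c : Subset (suc (suc m)) → ℚ) → InI01 (Xcomb c) → β² c ≈B zeroB
InI01⇒β²≈0 {m} c (e , e-I01 , Xc≈Xe) w = trans (β²-eval c w) (Xcomb-zero c00≗0 w)
  where
  c00≗0 : ∀ J → restrict00 c J ≡ 0ℚ
  c00≗0 J = trans (Xcomb-injective c e Xc≈Xe (false ∷ false ∷ J)) (e-I01 (false ∷ false ∷ J) refl)

π≈0⇒InP° : ∀ {m} (d : Subset (suc (suc m)) → ℚ) → π d ≈A zeroA → InP° (Pcomb d)
π≈0⇒InP° {m} d πd≈0 =
  d , λ u → trans (Pcomb-cong d (λ F → d (remove1 F)) remove1-invariant u) (sym (P°comb≈Pcomb d u))
  where
  remove1-invariant : ∀ F → inF F ≡ true → d F ≡ d (remove1 F)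
  remove1-invariant (false ∷ false ∷ G) _ = refl
  remove1-invariant (false ∷ true ∷ G) 01G∈𝓕
    with u , perm , Peak-u≡G ← Peak-realized G (noConsec-true∷⇒inF G 01G∈𝓕) =
    sym (x∙y⁻¹≈ε⇒x≈y _ _ (trans (sym (trans (π-eval d u) (cong₂ difference perm Peak-u≡G))) (πd≈0 u)))
    where
    difference : Bool → Subset m → ℚ
    difference b K = if b then d (false ∷ false ∷ K) - d (false ∷ true ∷ K) else 0ℚ

InP°⇒π≈0 : ∀ {m} (d : Subset (suc (suc m)) → ℚ) → InP° (Pcomb d) → π d ≈A zeroA
InP°⇒π≈0 {m} d (e , Pd≈P°e) u =
  trans (π-eval d u) (trans (cong (λ x → if isPerm u then x else 0ℚ) difference≡0) (if-0-else-0 (isPerm u)))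
  where
  d≗e∘remove1 : ∀ F → inF F ≡ true → d F ≡ e (remove1 F)
  d≗e∘remove1 = Pcomb-injective d (λ F → e (remove1 F)) (λ u → trans (Pd≈P°e u) (P°comb≈Pcomb e u))
  difference≡0 : d (false ∷ false ∷ Peak u) - d (false ∷ true ∷ Peak u) ≡ 0ℚ
  difference≡0 = trans (cong₂ _-_ (d≗e∘remove1 _ (inF-false∷false∷Peak u)) (d≗e∘remove1 _ (inF-false∷true∷Peak u)))
                       (+-inverseʳ (e (false ∷ false ∷ Peak u)))
  if-0-else-0 : ∀ b → (if b then 0ℚ else 0ℚ) ≡ 0ℚ
  if-0-else-0 true  = refl
  if-0-else-0 false = refl

φ-InI01 : ∀ {m} (f : QB (suc (suc m))) → InI01 f → InP° (φ f)
φ-InI01 {m} f (e , e-I01 , f≈Xe) = peakCoeff (suc (suc m)) false e , λ u →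
  trans (φ-cong f≈Xe u)
   (trans (φ-Xcomb e u)
    (trans (Pcomb-cong (peakCoeff _ false e) _ (λ F _ → peakCoeff-remove1 e e-I01 F) u)
           (sym (P°comb≈Pcomb (peakCoeff _ false e) u))))

φ-commutes : ∀ {m} (c : Subset (suc (suc m)) → ℚ) d → φ (Xcomb c) ≈A Pcomb d → π d ≈A φ (β² c)
φ-commutes {m} c d φXc≈Pd u = begin
  π d u
    ≡⟨ π-eval d u ⟩
  (if isPerm u then d (false ∷ false ∷ Peak u) - d (false ∷ true ∷ Peak u) else 0ℚ)
    ≡⟨ cong (λ x → if isPerm u then x else 0ℚ)
         (trans (cong₂ _-_ (d≗peakCoeff _ (inF-false∷false∷Peak u)) (d≗peakCoeff _ (inF-false∷true∷Peak u)))
                (peakCoeff-00-01 c (Peak u))) ⟩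
  (if isPerm u then peakCoeff m false (restrict00 c) (Peak u) else 0ℚ)
    ≡⟨ Pcomb-eval (peakCoeff m false (restrict00 c)) u ⟨
  Pcomb (peakCoeff m false (restrict00 c)) u
    ≡⟨ φ-Xcomb (restrict00 c) u ⟨
  φ (Xcomb (restrict00 c)) u
    ≡⟨ φ-cong (β²-eval c) u ⟨
  φ (β² c) u ∎
  where
  open ≡-Reasoning
  d≗peakCoeff : ∀ F → inF F ≡ true → d F ≡ peakCoeff (suc (suc m)) false c F
  d≗peakCoeff = Pcomb-injective d _ (λ u → trans (sym (φXc≈Pd u)) (φ-Xcomb c u))

φ-Xcomb-surjective : ∀ {n} (d : Subset n → ℚ) → ∃ λ c → φ (Xcomb c) ≈A Pcomb d
φ-Xcomb-surjective {n} d with c , c-solves ← peakCoeff-solve n d =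
  c , λ u → trans (φ-Xcomb c u) (Pcomb-cong (peakCoeff n false c) d (λ F F∈𝓕 → c-solves F (inF⇒noConsec F F∈𝓕)) u)

φ-InI01-surjective : ∀ {m} (e : Subset (suc (suc m)) → ℚ) → ∃ λ f → InI01 f × (φ f ≈A P°comb e)
φ-InI01-surjective {m} e with c , c-solves ← peakCoeff-solve m (λ F → ½ * e (false ∷ false ∷ F)) =
  Xcomb (only10 c) , (only10 c , only10-I01 , λ _ → refl) , λ u →
    trans (φ-Xcomb (only10 c) u)
     (trans (Pcomb-cong (peakCoeff _ false (only10 c)) (λ F → e (remove1 F)) matches u) (sym (P°comb≈Pcomb e u)))
  where
  only10-I01 : ∀ J → has01 J ≡ false → only10 c J ≡ 0ℚ
  only10-I01 (false ∷ false ∷ J) _ = refl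
  matches : ∀ F → inF F ≡ true → peakCoeff (suc (suc m)) false (only10 c) F ≡ e (remove1 F)
  matches (false ∷ f₁ ∷ F) F∈𝓕 =
    trans (peakCoeff-only10 c F f₁) (trans (cong (two *_) (c-solves F (noConsec-∷ f₁ F F∈𝓕))) (two*½ _))

corollary5p10 : (m : ℕ) → Corollary5p10 m
corollary5p10 m = record
  { I01⊆Σ      = λ { f (e , _ , f≈Xe) → e , f≈Xe }
  ; P°⊆P       = λ e → (λ F → e (remove1 F)) , P°comb≈Pcomb e
  ; topExact   = λ c → β²≈0⇒InI01 c , InI01⇒β²≈0 c
  ; topSurj    = λ c' → liftAt00 c' , β²-eval (liftAt00 c')
  ; botExact   = λ d → π≈0⇒InP° d , InP°⇒π≈0 d
  ; botSurj    = λ d' → liftAt00 d' , π-liftAt00 d'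
  ; φI01       = φ-InI01
  ; φΣn        = λ c → peakCoeff (suc (suc m)) false c , φ-Xcomb c
  ; φΣm        = λ c → peakCoeff m false c , φ-Xcomb c
  ; commute    = φ-commutes
  ; φI01-surj  = φ-InI01-surjective
  ; φΣn-surj   = φ-Xcomb-surjective
  ; φΣm-surj   = φ-Xcomb-surjective
  }
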